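{- Let integers $1\le r\le s<n$ be given, and let $(d_1,\ldots,d_n)$ be a nondecreasing sequence of nonnegative integers with $d_n<n$ which is $(r,s)$-large. Then every sequence $(e_1,\ldots,e_{n-1})$ obtained from $(d_1,\ldots,d_n)$ by deleting one arbitrary term is also $(r,s)$-large.
   Context: For integers $1\le r\le s\le m$, a nondecreasing sequence $(c_1,\ldots,c_m)$ of nonnegative integers is called $(r,s)$-large if (a) $c_r\ge r$ and $c_s\ge s+1$, and (b) if $m\ge 2s-r+2$ and $c_{2s-r+2}=s+1$, then there is an integer $j\in[2s-r+3,m]$ such that $c_j\ge j$. -}

module Defs where

open import Data.Nat using (ℕ; zero; suc; _+_; _∸_; _≤_; _<_)
open import Data.Fin using (Fin; toℕ)
open import Data.Vec using (Vec; lookup)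
open import Data.Product using (∃-syntax; _×_)
open import Relation.Binary.PropositionalEquality using (_≡_)

-- A sequence (c_1,...,c_m) is a vector of length m; position k (1-based)
-- corresponds to the index i : Fin m with toℕ i + 1 ≡ k.

NonDecreasing : {m : ℕ} → Vec ℕ m → Set
NonDecreasing {m} c = (i j : Fin m) → toℕ i ≤ toℕ j → lookup c i ≤ lookup c j

-- (r,s)-large (the standing assumption 1 ≤ r ≤ s ≤ m is imposed where used)
RSLarge : (r s : ℕ) {m : ℕ} → Vec ℕ m → Set
RSLarge r s {m} c =
  ((i : Fin m) → suc (toℕ i) ≡ r → r ≤ lookup c i)
  ×
  ((i : Fin m) → suc (toℕ i) ≡ s → suc s ≤ lookup c i)
  ×
  ((i : Fin m) → suc (toℕ i) ≡ (s + s ∸ r) + 2 → lookup c i ≡ suc s →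
     ∃[ j ] ((s + s ∸ r) + 3 ≤ suc (toℕ j) × suc (toℕ j) ≤ lookup c j))

-- Deleting a term never decreases the term at a given position p, because the
-- new p-th term is an old term at a position ≥ p; this settles condition (a).
-- For (b), if the new term at t = 2s-r+2 equals s+1, the old one is squeezed
-- between d_s ≥ s+1 and s+1, so the old sequence supplies j ≥ 2s-r+3 with
-- d_j ≥ j. Since j ≤ d_j ≤ d_n < n, position j is not the last one, so it
-- survives the deletion with e_j ≥ d_j ≥ j.
module Submission where

open import Defs
open import Data.Nat using (ℕ; suc; _≤_; _<_; _+_; _∸_; s≤s; s≤s⁻¹)
open import Data.Nat.Properties
  using (≤-refl; ≤-reflexive; ≤-trans; ≤-antisym; <⇒≤; <⇒≢; n≤1+n; m≤m+n; m≤n⇒m≤n+o; +-∸-assoc)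
open import Data.Fin using (Fin; zero; suc; toℕ; fromℕ; fromℕ<; inject₁; punchIn; lower₁)
open import Data.Fin.Properties
  using (toℕ-inject₁; toℕ-fromℕ; toℕ-fromℕ<; toℕ-lower₁; toℕ≤pred[n];
         inject₁-lower₁; punchInᵢ≢i; punchOut-punchIn)
open import Data.Vec using (Vec; []; _∷_; last; lookup; removeAt)
open import Data.Vec.Properties using (removeAt-punchOut)
open import Data.Product using (∃-syntax; _×_; _,_)
open import Function using (_∘_)
open import Relation.Binary.PropositionalEquality
  using (_≡_; _≢_; refl; sym; trans; cong; subst; subst₂)

private
  variable
    A : Set
    n : ℕ

lookup-removeAt : (xs : Vec A (suc n)) (i : Fin (suc n)) (j : Fin n) →
                  lookup (removeAt xs i) j ≡ lookup xs (punchIn i j)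
lookup-removeAt xs i j =
  trans (cong (lookup (removeAt xs i)) (sym (punchOut-punchIn i)))
        (removeAt-punchOut xs (punchInᵢ≢i i j ∘ sym))

toℕ-inject₁≤toℕ-punchIn : (i : Fin (suc n)) (j : Fin n) → toℕ (inject₁ j) ≤ toℕ (punchIn i j)
toℕ-inject₁≤toℕ-punchIn zero    j       = subst (_≤ suc (toℕ j)) (sym (toℕ-inject₁ j)) (n≤1+n (toℕ j))
toℕ-inject₁≤toℕ-punchIn (suc i) zero    = ≤-refl
toℕ-inject₁≤toℕ-punchIn (suc i) (suc j) = s≤s (toℕ-inject₁≤toℕ-punchIn i j)

last≡lookup-fromℕ : (xs : Vec A (suc n)) → last xs ≡ lookup xs (fromℕ n)
last≡lookup-fromℕ (x ∷ [])     = refl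
last≡lookup-fromℕ (x ∷ y ∷ ys) = last≡lookup-fromℕ (y ∷ ys)

n≤n+n∸m+2 : {m n : ℕ} → m ≤ n → n ≤ n + n ∸ m + 2
n≤n+n∸m+2 {m} {n} m≤n =
  m≤n⇒m≤n+o 2 (subst (n ≤_) (sym (+-∸-assoc n m≤n)) (m≤m+n n (n ∸ m)))

lookup≤last : (d : Vec ℕ (suc n)) → NonDecreasing d → (j : Fin (suc n)) → lookup d j ≤ last d
lookup≤last {n} d d↑ j =
  subst (lookup d j ≤_) (sym (last≡lookup-fromℕ d))
        (d↑ j (fromℕ n) (subst (toℕ j ≤_) (sym (toℕ-fromℕ n)) (toℕ≤pred[n] j)))

lookup-inject₁≤lookup-removeAt : (d : Vec ℕ (suc n)) → NonDecreasing d →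
  (i : Fin (suc n)) (j : Fin n) → lookup d (inject₁ j) ≤ lookup (removeAt d i) j
lookup-inject₁≤lookup-removeAt d d↑ i j =
  subst (lookup d (inject₁ j) ≤_) (sym (lookup-removeAt d i j))
        (d↑ (inject₁ j) (punchIn i j) (toℕ-inject₁≤toℕ-punchIn i j))

lowerBound-propagates : {m : ℕ} (d : Vec ℕ m) → NonDecreasing d → {a b : ℕ} → 1 ≤ a → a ≤ m →
  ((p : Fin m) → suc (toℕ p) ≡ a → b ≤ lookup d p) →
  (q : Fin m) → a ≤ suc (toℕ q) → b ≤ lookup d q
lowerBound-propagates d d↑ (s≤s _) a≤m bound q a≤q =
  ≤-trans (bound p (cong suc (toℕ-fromℕ< a≤m)))
          (d↑ p q (subst (_≤ toℕ q) (sym (toℕ-fromℕ< a≤m)) (s≤s⁻¹ a≤q)))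
  where
  p = fromℕ< a≤m

removeAt-preserves-lowerBound : (d : Vec ℕ (suc n)) → NonDecreasing d → (i : Fin (suc n)) →
  {a b : ℕ} → ((p : Fin (suc n)) → suc (toℕ p) ≡ a → b ≤ lookup d p) →
  (p : Fin n) → suc (toℕ p) ≡ a → b ≤ lookup (removeAt d i) p
removeAt-preserves-lowerBound d d↑ i bound p p≡a =
  ≤-trans (bound (inject₁ p) (trans (cong suc (toℕ-inject₁ p)) p≡a))
          (lookup-inject₁≤lookup-removeAt d d↑ i p)

largePosition-survives-removeAt : (d : Vec ℕ (suc n)) → NonDecreasing d → last d < suc n →
  (i j : Fin (suc n)) → suc (toℕ j) ≤ lookup d j →
  ∃[ j′ ] (toℕ j′ ≡ toℕ j × suc (toℕ j′) ≤ lookup (removeAt d i) j′)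
largePosition-survives-removeAt {n} d d↑ last<n i j j≤dj =
  j′ , toℕ-lower₁ j n≢j ,
  ≤-trans (subst₂ (λ a q → suc a ≤ lookup d q)
                  (sym (toℕ-lower₁ j n≢j)) (sym (inject₁-lower₁ j n≢j)) j≤dj)
          (lookup-inject₁≤lookup-removeAt d d↑ i j′)
  where
  n≢j : n ≢ toℕ j
  n≢j = <⇒≢ (≤-trans j≤dj (≤-trans (lookup≤last d d↑ j) (s≤s⁻¹ last<n))) ∘ sym
  j′ = lower₁ j n≢j

fact2p2 : (r s k : ℕ) → 1 ≤ r → r ≤ s → s < suc k →
          (d : Vec ℕ (suc k)) → NonDecreasing d →
          last d < suc k →
          RSLarge r s d →
          (i : Fin (suc k)) → RSLarge r s (removeAt d i)
fact2p2 r s k 1≤r r≤s s<n d d↑ last<n (large-r , large-s , large-b) i =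
    removeAt-preserves-lowerBound d d↑ i large-r
  , removeAt-preserves-lowerBound d d↑ i large-s
  , condition-b
  where
  condition-b : (p : Fin k) → suc (toℕ p) ≡ s + s ∸ r + 2 → lookup (removeAt d i) p ≡ suc s →
                ∃[ j ] (s + s ∸ r + 3 ≤ suc (toℕ j) × suc (toℕ j) ≤ lookup (removeAt d i) j)
  condition-b p p≡t ep≡s+1 =
    let q≡t = trans (cong suc (toℕ-inject₁ p)) p≡t
        dq≤s+1 = ≤-trans (lookup-inject₁≤lookup-removeAt d d↑ i p) (≤-reflexive ep≡s+1)
        s+1≤dq = lowerBound-propagates d d↑ (≤-trans 1≤r r≤s) (<⇒≤ s<n) large-s (inject₁ p)
                   (subst (s ≤_) (sym q≡t) (n≤n+n∸m+2 r≤s))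
        j , t<j , j≤dj = large-b (inject₁ p) q≡t (≤-antisym dq≤s+1 s+1≤dq)
        j′ , j′≡j , j′≤ej′ = largePosition-survives-removeAt d d↑ last<n i j j≤dj
    in j′ , subst (s + s ∸ r + 3 ≤_) (cong suc (sym j′≡j)) t<j , j′≤ej′
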